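{- Let $G$ be a finite solvable, non-nilpotent Schur group and let $F=F(G)$ be its Fitting subgroup. If $F$ is cyclic, then $G/F$ is abelian.
   Context: $F(G)$ is the largest normal nilpotent subgroup of $G$. Schur group: for a finite group $G$ with identity $e$, an S-ring over $G$ is a subring $\mathcal A=\mathrm{Span}_{\mathbb Z}\{\underline X:X\in\mathcal S\}$ of $\mathbb ZG$ where $\mathcal S$ is a partition of $G$ with $\{e\}\in\mathcal S$ and $X^{ -1}\in\mathcal S$ for $X\in\mathcal S$, and $\underline X$ is the sum of the elements of $X$; it is schurian if $\mathcal S$ is the set of orbits of the stabilizer $\Gamma_e$ for some $\Gamma\le\mathrm{Sym}(G)$ containing the group of right multiplications; $G$ is a Schur group if every S-ring over $G$ is schurian. -}

module Defs where

open import Level using (Level; 0ℓ) renaming (suc to lsuc)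
open import Data.Nat using (ℕ; zero; suc)
open import Data.Fin using (Fin)
import Data.Fin as F
open import Data.Integer using (ℤ; 0ℤ) renaming (_+_ to _+ℤ_; _*_ to _*ℤ_)
open import Data.Product using (Σ; ∃; ∃-syntax; _×_; _,_)
open import Data.Unit using (⊤)
open import Relation.Nullary using (¬_)
open import Relation.Binary.PropositionalEquality using (_≡_)
open import Function.Bundles using (_⇔_)

-- Finite groups: a group structure on the carrier Fin n (every finite
-- group is isomorphic to such a one; n = |G|).

record FinGroup (n : ℕ) : Set where
  field
    _·_   : Fin n → Fin n → Fin n
    e     : Fin n
    inv   : Fin n → Fin n
    assoc : ∀ x y z → (x · y) · z ≡ x · (y · z)
    idˡ   : ∀ x → e · x ≡ x
    idʳ   : ∀ x → x · e ≡ x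
    invˡ  : ∀ x → inv x · x ≡ e
    invʳ  : ∀ x → x · inv x ≡ e
  infixl 7 _·_

SubsetOf : ℕ → Set₁
SubsetOf n = Fin n → Set

module _ {n : ℕ} (G : FinGroup n) where
  open FinGroup G

  comm : Fin n → Fin n → Fin n
  comm x y = inv x · inv y · x · y

  pow : Fin n → ℕ → Fin n
  pow g zero    = e
  pow g (suc k) = pow g k · g

  IsSubgroup : SubsetOf n → Set
  IsSubgroup H = H e × (∀ x y → H x → H y → H (x · y)) × (∀ x → H x → H (inv x))

  IsNormalSubgroup : SubsetOf n → Set
  IsNormalSubgroup H = IsSubgroup H × (∀ g h → H h → H (g · h · inv g))

  data Gen (S : SubsetOf n) : SubsetOf n where
    gen  : ∀ {x} → S x → Gen S x
    gen-e : Gen S e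
    gen-· : ∀ {x y} → Gen S x → Gen S y → Gen S (x · y)
    gen-⁻¹ : ∀ {x} → Gen S x → Gen S (inv x)

  lowerCentral : SubsetOf n → ℕ → SubsetOf n
  lowerCentral H zero    = H
  lowerCentral H (suc i) =
    Gen (λ z → ∃[ a ] ∃[ b ] (lowerCentral H i a × H b × z ≡ comm a b))

  Nilpotent : SubsetOf n → Set
  Nilpotent H = Σ ℕ λ c → (∀ x → lowerCentral H c x → x ≡ e)

  derived : ℕ → SubsetOf n
  derived zero    = λ _ → ⊤
  derived (suc i) =
    Gen (λ z → ∃[ a ] ∃[ b ] (derived i a × derived i b × z ≡ comm a b))

  Solvable : Set
  Solvable = Σ ℕ λ k → (∀ x → derived k x → x ≡ e)

  NilpotentGroup : Set
  NilpotentGroup = Nilpotent (λ _ → ⊤)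

  IsFittingSubgroup : SubsetOf n → Set₁
  IsFittingSubgroup F =
    IsNormalSubgroup F × Nilpotent F ×
    (∀ (N : SubsetOf n) → IsNormalSubgroup N → Nilpotent N → ∀ x → N x → F x)

  Cyclic : SubsetOf n → Set
  Cyclic H = ∃[ g ] (H g × (∀ x → H x → ∃[ k ] (x ≡ pow g k)))

  -- for a normal subgroup N, G/N is abelian: the cosets (xy)N and (yx)N agree,
  -- i.e. (yx)⁻¹(xy) ∈ N, for all x y
  QuotientAbelian : SubsetOf n → Set
  QuotientAbelian N = ∀ x y → N (inv (y · x) · (x · y))

  ℤG : Set
  ℤG = Fin n → ℤ

  sumFin : ∀ {m} → (Fin m → ℤ) → ℤ
  sumFin {zero}  f = 0ℤ
  sumFin {suc m} f = f F.zero +ℤ sumFin (λ i → f (F.suc i))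

  _⋆_ : ℤG → ℤG → ℤG
  (f ⋆ g) z = sumFin (λ x → f x *ℤ g (inv x · z))

  -- A partition 𝒮 of G into k (nonempty) blocks, given by the block map
  -- c : G → Fin k (block i is X_i = c⁻¹(i)).

  module _ {k : ℕ} (c : Fin n → Fin k) where

    -- f ∈ Span_ℤ { X̲ : X ∈ 𝒮 }   (f = Σᵢ aᵢ X̲ᵢ)
    InSpan : ℤG → Set
    InSpan f = Σ (Fin k → ℤ) (λ a → ∀ z → f z ≡ a (c z))

    IsSRing : Set
    IsSRing =
      -- 𝒮 is a partition (all blocks nonempty)
      (∀ (i : Fin k) → ∃[ x ] (c x ≡ i)) ×
      -- {e} ∈ 𝒮
      (∀ x → c x ≡ c e → x ≡ e) ×
      -- X ∈ 𝒮 ⇒ X⁻¹ ∈ 𝒮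
      (∀ (i : Fin k) → ∃[ j ] (∀ x → (c x ≡ i) ⇔ (c (inv x) ≡ j))) ×
      -- the span is a subring of ℤG (it always contains 1 = {e}̲ and is an
      -- additive subgroup; closure under multiplication)
      (∀ f g → InSpan f → InSpan g → InSpan (f ⋆ g))

    -- Γ ≤ Sym(G) (permutations represented as functions G → G)
    IsPermGroup : ((Fin n → Fin n) → Set) → Set
    IsPermGroup Γ =
      (∀ σ → Γ σ → ∀ x y → σ x ≡ σ y → x ≡ y) ×
      (∃[ ι ] (Γ ι × ∀ x → ι x ≡ x)) ×
      (∀ σ τ → Γ σ → Γ τ → ∃[ ρ ] (Γ ρ × ∀ x → ρ x ≡ σ (τ x))) ×
      (∀ σ → Γ σ → ∃[ τ ] (Γ τ × ∀ x → τ (σ x) ≡ x))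

    -- the S-ring is schurian: 𝒮 is the set of orbits of the stabilizer Γₑ of e
    -- for some Γ ≤ Sym(G) containing all right multiplications x ↦ x g
    Schurian : Set₁
    Schurian =
      Σ ((Fin n → Fin n) → Set) λ Γ → (IsPermGroup Γ ×
              (∀ g → ∃[ ρ ] (Γ ρ × ∀ x → ρ x ≡ x · g)) ×
              (∀ x y → (c x ≡ c y) ⇔ (∃[ σ ] (Γ σ × σ e ≡ e × σ x ≡ y))))

  SchurGroup : Set₁
  SchurGroup = ∀ (k : ℕ) (c : Fin n → Fin k) → IsSRing c → Schurian c

module Submission where

-- Let G be a finite solvable group whose Fitting subgroup F is cyclic.  We show
-- that G/F is abelian.
--
-- 1. Conjugation x ↦ c_x is a homomorphism G → Aut(G), and automorphisms of a
--    cyclic group are power maps f ↦ fᵃ, so they commute.  Hence, for the normal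
--    cyclic subgroup F, c_{xy} and c_{yx} agree on F, i.e. the element
--    (yx)⁻¹(xy) centralises F.
-- 2. In a solvable group the Fitting subgroup contains its centraliser:
--    C_G(F) ≤ F.  By descending induction along the derived series
--    G = G⁽⁰⁾ ≥ … ≥ G⁽ᵏ⁾ = 1 we show C_G(F) ∩ G⁽ⁱ⁾ ≤ F.  If this holds for i+1,
--    then A = C_G(F) ∩ G⁽ⁱ⁾ is a normal subgroup with [A, A] ≤ F, and A
--    centralises F, so A is nilpotent of class at most 2; maximality of F
--    gives A ≤ F.
-- Together: (yx)⁻¹(xy) ∈ C_G(F) ≤ F for all x, y, which is G/F abelian.

open import Defs
open import Level using (Level; 0ℓ)
open import Algebra.Bundles using (Group)
open import Data.Nat using (ℕ; zero; suc; _+_; _*_)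
open import Data.Nat.Properties using (+-identityʳ; +-suc; +-comm; *-suc; *-zeroʳ; *-comm)
open import Data.Fin using (Fin)
open import Data.Product using (∃; _×_; _,_; proj₁; proj₂)
open import Data.Unit using (tt)
open import Relation.Nullary using (¬_)
open import Relation.Binary.PropositionalEquality
open ≡-Reasoning

descend : ∀ {ℓ : Level} (P : ℕ → Set ℓ) (k : ℕ) → P k → (∀ i → P (suc i) → P i) → P 0
descend P zero    Pk step = Pk
descend P (suc k) Pk step = step 0 (descend (λ i → P (suc i)) k Pk (λ i → step (suc i)))

module _ {n : ℕ} (G : FinGroup n) where
  open FinGroup G

  asGroup : Group 0ℓ 0ℓ
  asGroup = record
    { Carrier = Fin n ; _≈_ = _≡_ ; _∙_ = _·_ ; ε = e ; _⁻¹ = inv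
    ; isGroup = record
      { isMonoid = record
        { isSemigroup = record
          { isMagma = record { isEquivalence = isEquivalence ; ∙-cong = cong₂ _·_ }
          ; assoc = assoc }
        ; identity = idˡ , idʳ }
      ; inverse = invˡ , invʳ
      ; ⁻¹-cong = cong inv } }

  open import Algebra.Properties.Group asGroup
    using (quasigroup; inverseʳ-unique; ε⁻¹≈ε; ⁻¹-anti-homo-∙; \\-leftDividesʳ)
  open import Algebra.Properties.Quasigroup quasigroup using (cancelˡ)

  comm-trivial : ∀ a b → a · b ≡ b · a → comm G a b ≡ e
  comm-trivial a b ab≡ba = begin
    inv a · inv b · a · b         ≡⟨ assoc _ _ _ ⟩
    inv a · inv b · (a · b)       ≡⟨ cong (inv a · inv b ·_) ab≡ba ⟩
    inv a · inv b · (b · a)       ≡⟨ assoc _ _ _ ⟩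
    inv a · (inv b · (b · a))     ≡⟨ cong (inv a ·_) (\\-leftDividesʳ b a) ⟩
    inv a · a                     ≡⟨ invˡ a ⟩
    e                             ∎

  pow-+ : ∀ g a b → pow G g (a + b) ≡ pow G g a · pow G g b
  pow-+ g a zero    = trans (cong (pow G g) (+-identityʳ a)) (sym (idʳ _))
  pow-+ g a (suc b) = begin
    pow G g (a + suc b)              ≡⟨ cong (pow G g) (+-suc a b) ⟩
    pow G g (a + b) · g              ≡⟨ cong (_· g) (pow-+ g a b) ⟩
    pow G g a · pow G g b · g        ≡⟨ assoc _ _ _ ⟩
    pow G g a · pow G g (suc b)      ∎

  pow-* : ∀ g a b → pow G (pow G g a) b ≡ pow G g (a * b)
  pow-* g a zero    = cong (pow G g) (sym (*-zeroʳ a))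
  pow-* g a (suc b) = begin
    pow G (pow G g a) b · pow G g a  ≡⟨ cong (_· pow G g a) (pow-* g a b) ⟩
    pow G g (a * b) · pow G g a      ≡⟨ sym (pow-+ g (a * b) a) ⟩
    pow G g (a * b + a)              ≡⟨ cong (pow G g) (trans (+-comm (a * b) a) (sym (*-suc a b))) ⟩
    pow G g (a * suc b)              ∎

  conj : Fin n → Fin n → Fin n
  conj h f = h · f · inv h

  conj-hom : ∀ h a b → conj h (a · b) ≡ conj h a · conj h b
  conj-hom h a b = sym (begin
    h · a · inv h · (h · b · inv h)    ≡⟨ assoc _ _ _ ⟩
    h · a · (inv h · (h · b · inv h))  ≡⟨ cong (h · a ·_) (sym (assoc _ _ _)) ⟩
    h · a · (inv h · (h · b) · inv h)  ≡⟨ cong (λ t → h · a · (t · inv h)) (\\-leftDividesʳ h b) ⟩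
    h · a · (b · inv h)                ≡⟨ sym (assoc _ _ _) ⟩
    h · a · b · inv h                  ≡⟨ cong (_· inv h) (assoc _ _ _) ⟩
    h · (a · b) · inv h                ∎)

  conj-e : ∀ h → conj h e ≡ e
  conj-e h = trans (cong (_· inv h) (idʳ h)) (invʳ h)

  conj-inv : ∀ h a → conj h (inv a) ≡ inv (conj h a)
  conj-inv h a = inverseʳ-unique (conj h a) (conj h (inv a))
    (trans (sym (conj-hom h a (inv a))) (trans (cong (conj h) (invʳ a)) (conj-e h)))

  conj-pow : ∀ h g m → conj h (pow G g m) ≡ pow G (conj h g) m
  conj-pow h g zero    = conj-e h
  conj-pow h g (suc m) = trans (conj-hom h (pow G g m) g) (cong (_· conj h g) (conj-pow h g m))

  conj-comm : ∀ h a b → conj h (comm G a b) ≡ comm G (conj h a) (conj h b)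
  conj-comm h a b = begin
    conj h (inv a · inv b · a · b)                    ≡⟨ conj-hom h _ b ⟩
    conj h (inv a · inv b · a) · conj h b             ≡⟨ cong (_· conj h b) (conj-hom h _ a) ⟩
    conj h (inv a · inv b) · conj h a · conj h b      ≡⟨ cong (λ t → t · conj h a · conj h b) (conj-hom h _ _) ⟩
    conj h (inv a) · conj h (inv b) · conj h a · conj h b
      ≡⟨ cong (λ t → t · conj h a · conj h b) (cong₂ _·_ (conj-inv h a) (conj-inv h b)) ⟩
    comm G (conj h a) (conj h b)                      ∎

  conj-· : ∀ x y f → conj (x · y) f ≡ conj x (conj y f)
  conj-· x y f = begin
    x · y · f · inv (x · y)          ≡⟨ cong (x · y · f ·_) (⁻¹-anti-homo-∙ x y) ⟩
    x · y · f · (inv y · inv x)      ≡⟨ sym (assoc _ _ _) ⟩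
    x · y · f · inv y · inv x        ≡⟨ cong (λ t → t · inv y · inv x) (assoc x y f) ⟩
    x · (y · f) · inv y · inv x      ≡⟨ cong (_· inv x) (assoc x (y · f) (inv y)) ⟩
    x · (y · f · inv y) · inv x      ∎

  conj-undo : ∀ g f → conj g (conj (inv g) f) ≡ f
  conj-undo g f = begin
    conj g (conj (inv g) f)    ≡⟨ sym (conj-· g (inv g) f) ⟩
    conj (g · inv g) f         ≡⟨ cong (λ t → conj t f) (invʳ g) ⟩
    e · f · inv e              ≡⟨ cong₂ _·_ (idˡ f) ε⁻¹≈ε ⟩
    f · e                      ≡⟨ idʳ f ⟩
    f                          ∎

  same-conj⇒commute : ∀ u w f → conj u f ≡ conj w f → inv w · u · f ≡ f · (inv w · u)
  same-conj⇒commute u w f same = begin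
    inv w · u · f                  ≡⟨ assoc _ _ _ ⟩
    inv w · (u · f)                ≡⟨ cong (inv w ·_) uf≡ ⟩
    inv w · (conj u f · u)         ≡⟨ cong (λ t → inv w · (t · u)) same ⟩
    inv w · (w · f · inv w · u)    ≡⟨ cong (inv w ·_) (assoc _ _ _) ⟩
    inv w · (w · f · (inv w · u))  ≡⟨ sym (assoc _ _ _) ⟩
    inv w · (w · f) · (inv w · u)  ≡⟨ cong (_· (inv w · u)) (\\-leftDividesʳ w f) ⟩
    f · (inv w · u)                ∎
    where
    uf≡ : u · f ≡ conj u f · u
    uf≡ = sym (trans (assoc _ _ _) (trans (cong (u · f ·_) (invˡ u)) (idʳ _)))

  ConjClosed : SubsetOf n → Set
  ConjClosed H = ∀ g h → H h → H (conj g h)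

  subgroup-comm : ∀ H → IsSubgroup G H → ∀ a b → H a → H b → H (comm G a b)
  subgroup-comm H (_ , mul , inverse) a b Ha Hb =
    mul _ b (mul _ a (mul _ _ (inverse a Ha) (inverse b Hb)) Ha) Hb

  ∩-normal : ∀ H K → IsNormalSubgroup G H → IsNormalSubgroup G K →
             IsNormalSubgroup G (λ x → H x × K x)
  ∩-normal H K ((He , Hmul , Hinv) , Hconj) ((Ke , Kmul , Kinv) , Kconj) =
    ( (He , Ke)
    , (λ x y (Hx , Kx) (Hy , Ky) → Hmul x y Hx Hy , Kmul x y Kx Ky)
    , (λ x (Hx , Kx) → Hinv x Hx , Kinv x Kx) )
    , (λ g h (Hh , Kh) → Hconj g h Hh , Kconj g h Kh)

  trivial-subgroup : IsSubgroup G (λ z → z ≡ e)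
  trivial-subgroup =
    refl , (λ x y x≡e y≡e → trans (cong₂ _·_ x≡e y≡e) (idˡ e)) , (λ x x≡e → trans (cong inv x≡e) ε⁻¹≈ε)

  Gen-least : ∀ S T → IsSubgroup G T → (∀ z → S z → T z) → ∀ z → Gen G S z → T z
  Gen-least S T _                 S⊆T z (gen s)   = S⊆T z s
  Gen-least S T (Te , _ , _)      S⊆T z gen-e     = Te
  Gen-least S T T≤@(_ , mul , _)  S⊆T z (gen-· {x} {y} p q) =
    mul x y (Gen-least S T T≤ S⊆T x p) (Gen-least S T T≤ S⊆T y q)
  Gen-least S T T≤@(_ , _ , inverse) S⊆T z (gen-⁻¹ {x} p) =
    inverse x (Gen-least S T T≤ S⊆T x p)

  Gen-conjClosed : ∀ S → ConjClosed S → ConjClosed (Gen G S)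
  Gen-conjClosed S S-conj g z (gen s) = gen (S-conj g z s)
  Gen-conjClosed S S-conj g z gen-e   = subst (Gen G S) (sym (conj-e g)) gen-e
  Gen-conjClosed S S-conj g z (gen-· {x} {y} p q) =
    subst (Gen G S) (sym (conj-hom g x y))
      (gen-· (Gen-conjClosed S S-conj g x p) (Gen-conjClosed S S-conj g y q))
  Gen-conjClosed S S-conj g z (gen-⁻¹ {x} p) =
    subst (Gen G S) (sym (conj-inv g x)) (gen-⁻¹ (Gen-conjClosed S S-conj g x p))

  derived-normal : ∀ i → IsNormalSubgroup G (derived G i)
  derived-normal zero    = (tt , (λ _ _ _ _ → tt) , (λ _ _ → tt)) , (λ _ _ _ → tt)
  derived-normal (suc i) = (gen-e , (λ _ _ → gen-·) , (λ _ → gen-⁻¹)) , Gen-conjClosed _ commutators-conj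
    where
    commutators-conj : ConjClosed (λ z → ∃ λ a → ∃ λ b → derived G i a × derived G i b × z ≡ comm G a b)
    commutators-conj g z (a , b , Da , Db , z≡) =
      conj g a , conj g b , proj₂ (derived-normal i) g a Da , proj₂ (derived-normal i) g b Db ,
      trans (cong (conj g) z≡) (conj-comm g a b)

  -- A subset N whose commutators lie in a subgroup Z centralised by N is
  -- nilpotent of class at most 2: γ₁(N) ≤ Z and γ₂(N) = [γ₁(N), N] = 1.
  class-two-nilpotent : ∀ N Z → IsSubgroup G Z →
    (∀ a b → N a → N b → Z (comm G a b)) → (∀ z b → Z z → N b → b · z ≡ z · b) →
    Nilpotent G N
  class-two-nilpotent N Z Z≤ comm∈Z Z-central = 2 , Gen-least _ _ trivial-subgroup γ₂-trivial
    where
    γ₁⊆Z : ∀ z → lowerCentral G N 1 z → Z z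
    γ₁⊆Z = Gen-least _ Z Z≤ λ z (a , b , Na , Nb , z≡) → subst Z (sym z≡) (comm∈Z a b Na Nb)
    γ₂-trivial : ∀ z → (∃ λ a → ∃ λ b → lowerCentral G N 1 a × N b × z ≡ comm G a b) → z ≡ e
    γ₂-trivial z (a , b , γ₁a , Nb , z≡) =
      trans z≡ (comm-trivial a b (sym (Z-central a b (γ₁⊆Z a γ₁a) Nb)))

  Centralizer : SubsetOf n → SubsetOf n
  Centralizer F x = ∀ f → F f → x · f ≡ f · x

  centralizer-subgroup : ∀ F → IsSubgroup G (Centralizer F)
  centralizer-subgroup F = C-e , C-· , C-inv
    where
    C-e : Centralizer F e
    C-e f _ = trans (idˡ f) (sym (idʳ f))
    C-· : ∀ x y → Centralizer F x → Centralizer F y → Centralizer F (x · y)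
    C-· x y Cx Cy f Ff = begin
      x · y · f     ≡⟨ assoc _ _ _ ⟩
      x · (y · f)   ≡⟨ cong (x ·_) (Cy f Ff) ⟩
      x · (f · y)   ≡⟨ sym (assoc _ _ _) ⟩
      x · f · y     ≡⟨ cong (_· y) (Cx f Ff) ⟩
      f · x · y     ≡⟨ assoc _ _ _ ⟩
      f · (x · y)   ∎
    C-inv : ∀ x → Centralizer F x → Centralizer F (inv x)
    C-inv x Cx f Ff = cancelˡ x _ _ (begin
      x · (inv x · f)   ≡⟨ sym (assoc _ _ _) ⟩
      x · inv x · f     ≡⟨ cong (_· f) (invʳ x) ⟩
      e · f             ≡⟨ idˡ f ⟩
      f                 ≡⟨ sym (idʳ f) ⟩
      f · e             ≡⟨ cong (f ·_) (sym (invʳ x)) ⟩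
      f · (x · inv x)   ≡⟨ sym (assoc _ _ _) ⟩
      f · x · inv x     ≡⟨ cong (_· inv x) (sym (Cx f Ff)) ⟩
      x · f · inv x     ≡⟨ assoc _ _ _ ⟩
      x · (f · inv x)   ∎)

  centralizer-normal : ∀ F → ConjClosed F → IsNormalSubgroup G (Centralizer F)
  centralizer-normal F F-conj = centralizer-subgroup F , C-conj
    where
    C-conj : ConjClosed (Centralizer F)
    C-conj g h Ch f Ff = begin
      conj g h · f            ≡⟨ cong (conj g h ·_) (sym (conj-undo g f)) ⟩
      conj g h · conj g f'    ≡⟨ sym (conj-hom g h f') ⟩
      conj g (h · f')         ≡⟨ cong (conj g) (Ch f' (F-conj (inv g) f Ff)) ⟩
      conj g (f' · h)         ≡⟨ conj-hom g f' h ⟩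
      conj g f' · conj g h    ≡⟨ cong (_· conj g h) (conj-undo g f) ⟩
      f · conj g h            ∎
      where
      f' : Fin n
      f' = conj (inv g) f

  -- Step 1.  Conjugations by x y and y x agree on a normal cyclic subgroup F:
  -- with F = ⟨g⟩, xgx⁻¹ = gᵃ and ygy⁻¹ = gᵇ, both send g to g^(ab).
  -- Consequently (yx)⁻¹(xy) centralises F.
  cyclic-conj-commute : ∀ F → ConjClosed F → Cyclic G F →
    ∀ x y f → F f → conj (x · y) f ≡ conj (y · x) f
  cyclic-conj-commute F F-conj (g , Fg , generated) x y f Ff
    with generated (conj x g) (F-conj x g Fg) | generated (conj y g) (F-conj y g Fg) | generated f Ff
  ... | (a , xg≡gᵃ) | (b , yg≡gᵇ) | (m , f≡gᵐ) = begin
    conj (x · y) f                  ≡⟨ cong (conj (x · y)) f≡gᵐ ⟩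
    conj (x · y) (pow G g m)        ≡⟨ conj-pow (x · y) g m ⟩
    pow G (conj (x · y) g) m        ≡⟨ cong (λ t → pow G t m) (trans (acts x y a b xg≡gᵃ yg≡gᵇ) (cong (pow G g) (*-comm a b))) ⟩
    pow G (pow G g (b * a)) m       ≡⟨ cong (λ t → pow G t m) (sym (acts y x b a yg≡gᵇ xg≡gᵃ)) ⟩
    pow G (conj (y · x) g) m        ≡⟨ sym (conj-pow (y · x) g m) ⟩
    conj (y · x) (pow G g m)        ≡⟨ cong (conj (y · x)) (sym f≡gᵐ) ⟩
    conj (y · x) f                  ∎
    where
    acts : ∀ u v a b → conj u g ≡ pow G g a → conj v g ≡ pow G g b → conj (u · v) g ≡ pow G g (a * b)
    acts u v a b ug≡ vg≡ = begin
      conj (u · v) g          ≡⟨ conj-· u v g ⟩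
      conj u (conj v g)       ≡⟨ cong (conj u) vg≡ ⟩
      conj u (pow G g b)      ≡⟨ conj-pow u g b ⟩
      pow G (conj u g) b      ≡⟨ cong (λ t → pow G t b) ug≡ ⟩
      pow G (pow G g a) b     ≡⟨ pow-* g a b ⟩
      pow G g (a * b)         ∎

  cyclic⇒commutator-centralizes : ∀ F → ConjClosed F → Cyclic G F →
    ∀ x y → Centralizer F (inv (y · x) · (x · y))
  cyclic⇒commutator-centralizes F F-conj cyc x y f Ff =
    same-conj⇒commute (x · y) (y · x) f (cyclic-conj-commute F F-conj cyc x y f Ff)

  -- Induction step: if C_G(F) ∩ G⁽ⁱ⁺¹⁾ ≤ F, then C_G(F) ∩ G⁽ⁱ⁾ is a normal
  -- subgroup of nilpotency class ≤ 2, hence contained in F.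
  module _ (F : SubsetOf n) (fitting : IsFittingSubgroup G F) where
    private
      F-normal : IsNormalSubgroup G F
      F-normal = proj₁ fitting
      F-maximal : ∀ N → IsNormalSubgroup G N → Nilpotent G N → ∀ x → N x → F x
      F-maximal = proj₂ (proj₂ fitting)

    CentralizerBelow : ℕ → Set
    CentralizerBelow i = ∀ x → Centralizer F x → derived G i x → F x

    centralizer-descend : ∀ i → CentralizerBelow (suc i) → CentralizerBelow i
    centralizer-descend i below x Cx Dx =
      F-maximal A A-normal A-nilpotent x (Cx , Dx)
      where
      A : SubsetOf n
      A x = Centralizer F x × derived G i x
      A-normal : IsNormalSubgroup G A
      A-normal = ∩-normal _ _ (centralizer-normal F (proj₂ F-normal)) (derived-normal i)
      A-nilpotent : Nilpotent G A
      A-nilpotent = class-two-nilpotent A F (proj₁ F-normal)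
        (λ a b (Ca , Da) (Cb , Db) →
          below (comm G a b) (subgroup-comm _ (centralizer-subgroup F) a b Ca Cb) (gen (a , b , Da , Db , refl)))
        (λ z b Fz (Cb , _) → Cb z Fz)

    centralizer⊆Fitting : Solvable G → ∀ x → Centralizer F x → F x
    centralizer⊆Fitting (k , derived-trivial) x Cx =
      descend CentralizerBelow k at-k centralizer-descend x Cx tt
      where
      at-k : CentralizerBelow k
      at-k x _ Dx = subst F (sym (derived-trivial x Dx)) (proj₁ (proj₁ F-normal))

lemma7p2 : ∀ {n : ℕ} (G : FinGroup n) → Solvable G → ¬ NilpotentGroup G → SchurGroup G →
           ∀ (F : SubsetOf n) → IsFittingSubgroup G F → Cyclic G F → QuotientAbelian G F
lemma7p2 G solvable _ _ F fitting cyclic x y =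
  centralizer⊆Fitting G F fitting solvable _
    (cyclic⇒commutator-centralizes G F (proj₂ (proj₁ fitting)) cyclic x y)
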